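{- Let $s,t\in\mathbb N$ with $s\ge5$ and $t\ge6$, let $k_1=\lfloor (s-1)/2\rfloor$ and $k_2=\lfloor (t-2)/2\rfloor$, and let $F=\{(i,j)\in[s]\times[t]\mid i\in[2]$ or $2k_1\le i\le s$ or $j=1$ or $2k_2<j\le t\}\cup\{(2i,2j)\mid i\in[k_1], j\in[k_2]\}$, $D=\{(2i+1,2j)\mid i\in[k_1-1], j\in[k_2]\}\cup\{(2i,2j+1)\mid 1<i<k_1, j\in[k_2-1]\}$. Then $(F,D)$ is a skeleton of the grid $G_{s,t}$.
   Context: The grid $G_{s,t}$ has vertex set $[s]\times[t]$ and edges $(i,j)(i',j')$ with $|i-i'|+|j-j'|=1$. An endomorphism of a graph $G$ is a map $h:V(G)\to V(G)$ with $h(u)h(v)\in E(G)$ for all $uv\in E(G)$. A set $F\subseteq V(G)$ is a frame for $G$ if every endomorphism $h$ of $G$ with $F\subseteq h(V(G))$ is surjective. A skeleton of $G$ is a pair $(F,D)$ of subsets of $V(G)$ such that $F$ is a frame for $G$, $F\cap D=\emptyset$, and every $v\in D$ has at most $2$ neighbours in $V(G)\setminus F$. -}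

module Defs where

open import Data.Nat using (ℕ; zero; suc; _+_; _*_; _∸_; _≤_; _<_; ⌊_/2⌋; ∣_-_∣)
open import Data.Fin using (Fin; toℕ)
open import Data.Product using (Σ; ∃; ∃-syntax; _×_; _,_)
open import Data.Sum using (_⊎_)
open import Relation.Binary.PropositionalEquality using (_≡_; _≢_)
open import Relation.Nullary using (¬_)

record Graph : Set₁ where
  field
    V   : Set
    Adj : V → V → Set

open Graph public

VSet : Graph → Set₁
VSet G = V G → Set

IsEndomorphism : (G : Graph) → (V G → V G) → Set
IsEndomorphism G h = ∀ u v → Adj G u v → Adj G (h u) (h v)

InImage : (G : Graph) → (V G → V G) → V G → Set
InImage G h v = ∃[ u ] (h u ≡ v)

Surjective : (G : Graph) → (V G → V G) → Set
Surjective G h = ∀ v → InImage G h v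

IsFrame : (G : Graph) → VSet G → Set
IsFrame G F = ∀ (h : V G → V G) → IsEndomorphism G h →
              (∀ v → F v → InImage G h v) → Surjective G h

AtMostTwoNbrsOutside : (G : Graph) → VSet G → V G → Set
AtMostTwoNbrsOutside G F v =
  ¬ (Σ (V G) λ a → Σ (V G) λ b → Σ (V G) λ c →
       (Adj G v a × ¬ F a) × (Adj G v b × ¬ F b) × (Adj G v c × ¬ F c) ×
       a ≢ b × a ≢ c × b ≢ c)

IsSkeleton : (G : Graph) → VSet G → VSet G → Set
IsSkeleton G F D =
  IsFrame G F ×
  (∀ v → ¬ (F v × D v)) ×
  (∀ v → D v → AtMostTwoNbrsOutside G F v)

-- The grid G_{s,t}. A vertex (a , b) : Fin s × Fin t stands for the
-- 1-indexed point (toℕ a + 1 , toℕ b + 1) ∈ [s] × [t].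
row : ∀ {s t} → Fin s × Fin t → ℕ
row (a , _) = suc (toℕ a)

col : ∀ {s t} → Fin s × Fin t → ℕ
col (_ , b) = suc (toℕ b)

Grid : ℕ → ℕ → Graph
Grid s t = record
  { V   = Fin s × Fin t
  ; Adj = λ u v → ∣ row u - row v ∣ + ∣ col u - col v ∣ ≡ 1
  }

k₁ : ℕ → ℕ
k₁ s = ⌊ s ∸ 1 /2⌋

k₂ : ℕ → ℕ
k₂ t = ⌊ t ∸ 2 /2⌋

-- F = {(i,j) | i ∈ [2] or 2k₁ ≤ i ≤ s or j = 1 or 2k₂ < j ≤ t}
--     ∪ {(2i,2j) | i ∈ [k₁], j ∈ [k₂]}
-- (i ≤ s and j ≤ t hold automatically for grid vertices.)
FSet : (s t : ℕ) → VSet (Grid s t)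
FSet s t v =
  (row v ≤ 2) ⊎ (2 * k₁ s ≤ row v) ⊎ (col v ≡ 1) ⊎ (2 * k₂ t < col v) ⊎
  (Σ ℕ λ i → Σ ℕ λ j → (1 ≤ i × i ≤ k₁ s) × (1 ≤ j × j ≤ k₂ t) ×
     row v ≡ 2 * i × col v ≡ 2 * j)

DSet : (s t : ℕ) → VSet (Grid s t)
DSet s t v =
  (Σ ℕ λ i → Σ ℕ λ j → (1 ≤ i × i ≤ k₁ s ∸ 1) × (1 ≤ j × j ≤ k₂ t) ×
     row v ≡ 2 * i + 1 × col v ≡ 2 * j)
  ⊎
  (Σ ℕ λ i → Σ ℕ λ j → (1 < i × i < k₁ s) × (1 ≤ j × j ≤ k₂ t ∸ 1) ×
     row v ≡ 2 * i × col v ≡ 2 * j + 1)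

-- An endomorphism h of the grid does not increase the ℓ¹ distance. If its image contains
-- the four corners, the preimages of two opposite corners are at distance at least the
-- diameter, so they are opposite corners too; as dist w p + dist w q equals the diameter
-- for opposite p, q, h preserves the distances to them. Distances to two adjacent corners
-- determine a point, so h is injective and hence, the grid being finite, surjective.
-- A vertex of D has its two neighbours along one axis among the lattice points
-- (2i, 2j) of F, so its neighbours outside F lie on a line through it; disjointness of
-- F and D is a parity argument.
module Submission where

open import Defs
open import Data.Nat using (ℕ; zero; suc; _+_; _*_; _∸_; _≤_; _<_; z≤n; s≤s; ∣_-_∣; ⌊_/2⌋; NonZero; ≢-nonZero⁻¹)
open import Data.Nat.Properties
open import Algebra.Properties.CommutativeSemigroup +-commutativeSemigroup using (interchange)
open import Data.Fin using (Fin; zero; suc; toℕ; fromℕ; inject₁; punchOut)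
open import Data.Fin.Properties
  using (toℕ-injective; toℕ-fromℕ; toℕ-inject₁; toℕ≤pred[n]; any?; injective⇒≤; punchOut-injective; *↔×)
  renaming (_≟_ to _≟ᶠ_)
open import Data.Product using (Σ; ∃; ∃₂; _×_; _,_; proj₁)
open import Data.Sum using (_⊎_; inj₁; inj₂)
open import Data.Empty using (⊥-elim)
open import Function using (Inverse; _↔_)
open import Function.Definitions using (Injective)
open import Relation.Nullary using (¬_; yes; no)
open import Relation.Binary.PropositionalEquality

injective⇒surjective : ∀ {n} (f : Fin n → Fin n) → Injective _≡_ _≡_ f → ∀ y → ∃ λ x → f x ≡ y
injective⇒surjective {suc n} f f-inj y with any? (λ x → f x ≟ᶠ y)
... | yes hit = hit
... | no miss = ⊥-elim (<-irrefl refl (injective⇒≤ g-inj))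
  where
  y≢f : ∀ x → y ≢ f x
  y≢f x y≡fx = miss (x , sym y≡fx)
  g : Fin (suc n) → Fin n
  g x = punchOut (y≢f x)
  g-inj : Injective _≡_ _≡_ g
  g-inj eq = f-inj (punchOut-injective (y≢f _) (y≢f _) eq)

↔-injective⇒surjective : ∀ {n} {A : Set} → Fin n ↔ A →
                         (f : A → A) → Injective _≡_ _≡_ f → ∀ y → ∃ λ x → f x ≡ y
↔-injective⇒surjective e f f-inj y =
  let i , g[i]≡from[y] = injective⇒surjective g g-inj (from y)
  in to i , from-injective g[i]≡from[y]
  where
  open Inverse e
  from-injective : Injective _≡_ _≡_ from
  from-injective {a} {b} eq = begin
    a             ≡⟨ strictlyInverseˡ a ⟨
    to (from a)   ≡⟨ cong to eq ⟩
    to (from b)   ≡⟨ strictlyInverseˡ b ⟩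
    b             ∎
    where open ≡-Reasoning
  g : Fin _ → Fin _
  g i = from (f (to i))
  g-inj : Injective _≡_ _≡_ g
  g-inj {i} {j} eq = begin
    i             ≡⟨ strictlyInverseʳ i ⟨
    from (to i)   ≡⟨ cong from (f-inj (from-injective eq)) ⟩
    from (to j)   ≡⟨ strictlyInverseʳ j ⟩
    j             ∎
    where open ≡-Reasoning

+-≤-squeeze : ∀ {a b m n} → a ≤ m → b ≤ n → m + n ≤ a + b → a ≡ m × b ≡ n
+-≤-squeeze {a} {b} {m} {n} a≤m b≤n m+n≤a+b = a≡m , b≡n
  where
  a≡m : a ≡ m
  a≡m = ≤-antisym a≤m (+-cancelʳ-≤ b m a (≤-trans (+-monoʳ-≤ m b≤n) m+n≤a+b))
  b≡n : b ≡ n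
  b≡n = ≤-antisym b≤n (+-cancelˡ-≤ m n b (≤-trans m+n≤a+b (+-monoˡ-≤ b a≤m)))

m+m≡n+n⇒m≡n : ∀ {m n} → m + m ≡ n + n → m ≡ n
m+m≡n+n⇒m≡n {m} {n} eq = *-cancelˡ-≡ m n 2 (begin
  2 * m   ≡⟨ cong (m +_) (+-identityʳ m) ⟩
  m + m   ≡⟨ eq ⟩
  n + n   ≡⟨ cong (n +_) (+-identityʳ n) ⟨
  2 * n   ∎)
  where open ≡-Reasoning

-- Summing the first two equations and cancelling the third gives x + x ≡ x′ + x′.
+-cancel-pairs : ∀ {x y z x′ y′ z′} → x + y ≡ x′ + y′ → x + z ≡ x′ + z′ → y + z ≡ y′ + z′ →
                 x ≡ x′ × y ≡ y′
+-cancel-pairs {x} {y} {z} {x′} {y′} {z′} e₁ e₂ e₃ = x≡x′ , +-cancelˡ-≡ x y y′ (trans e₁ (cong (_+ y′) (sym x≡x′)))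
  where
  open ≡-Reasoning
  x≡x′ : x ≡ x′
  x≡x′ = m+m≡n+n⇒m≡n (+-cancelʳ-≡ (y + z) (x + x) (x′ + x′) (begin
    (x + x) + (y + z)       ≡⟨ interchange x y x z ⟨
    (x + y) + (x + z)       ≡⟨ cong₂ _+_ e₁ e₂ ⟩
    (x′ + y′) + (x′ + z′)   ≡⟨ interchange x′ y′ x′ z′ ⟩
    (x′ + x′) + (y′ + z′)   ≡⟨ cong ((x′ + x′) +_) e₃ ⟨
    (x′ + x′) + (y + z)     ∎))

m+n≡1⇒m≡0×n≡1⊎m≡1×n≡0 : ∀ m n → m + n ≡ 1 → (m ≡ 0 × n ≡ 1) ⊎ (m ≡ 1 × n ≡ 0)
m+n≡1⇒m≡0×n≡1⊎m≡1×n≡0 zero       n    eq   = inj₁ (refl , eq)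
m+n≡1⇒m≡0×n≡1⊎m≡1×n≡0 (suc zero) zero refl = inj₂ (refl , refl)

∣m-n∣≡1⇒n≡1+m⊎m≡1+n : ∀ {m n} → ∣ m - n ∣ ≡ 1 → n ≡ suc m ⊎ m ≡ suc n
∣m-n∣≡1⇒n≡1+m⊎m≡1+n {zero}     {suc zero} refl = inj₁ refl
∣m-n∣≡1⇒n≡1+m⊎m≡1+n {suc zero} {zero}     refl = inj₂ refl
∣m-n∣≡1⇒n≡1+m⊎m≡1+n {suc m}    {suc n}    eq   with ∣m-n∣≡1⇒n≡1+m⊎m≡1+n {m} {n} eq
... | inj₁ n≡1+m = inj₁ (cong suc n≡1+m)
... | inj₂ m≡1+n = inj₂ (cong suc m≡1+n)

two-of-three-equal : ∀ {c x y z} → ∣ c - x ∣ ≡ 1 → ∣ c - y ∣ ≡ 1 → ∣ c - z ∣ ≡ 1 →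
                     x ≡ y ⊎ x ≡ z ⊎ y ≡ z
two-of-three-equal {c} {x} {y} {z} cx cy cz
  with ∣m-n∣≡1⇒n≡1+m⊎m≡1+n {c} {x} cx | ∣m-n∣≡1⇒n≡1+m⊎m≡1+n {c} {y} cy
     | ∣m-n∣≡1⇒n≡1+m⊎m≡1+n {c} {z} cz
... | inj₁ refl | inj₁ refl | _         = inj₁ refl
... | inj₂ refl | inj₂ refl | _         = inj₁ refl
... | inj₁ refl | inj₂ _    | inj₁ refl = inj₂ (inj₁ refl)
... | inj₂ refl | inj₁ _    | inj₂ refl = inj₂ (inj₁ refl)
... | inj₁ _    | inj₂ refl | inj₂ refl = inj₂ (inj₂ refl)
... | inj₂ _    | inj₁ refl | inj₁ refl = inj₂ (inj₂ refl)

Ends : ℕ → ℕ → ℕ → Set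
Ends n x y = (x ≡ 0 × y ≡ n) ⊎ (x ≡ n × y ≡ 0)

ends-unique : ∀ {n e e′ f f′} → Ends n e e′ → Ends n f f′ → f ≡ e ⊎ f ≡ e′
ends-unique (inj₁ (refl , refl)) (inj₁ (refl , refl)) = inj₁ refl
ends-unique (inj₁ (refl , refl)) (inj₂ (refl , refl)) = inj₂ refl
ends-unique (inj₂ (refl , refl)) (inj₁ (refl , refl)) = inj₂ refl
ends-unique (inj₂ (refl , refl)) (inj₂ (refl , refl)) = inj₁ refl

∣z-0∣+∣z-n∣≡n : ∀ {n} z → z ≤ n → ∣ z - 0 ∣ + ∣ z - n ∣ ≡ n
∣z-0∣+∣z-n∣≡n z z≤ = trans (cong₂ _+_ (∣-∣-identityʳ z) (m≤n⇒∣m-n∣≡n∸m z≤)) (m+[n∸m]≡n z≤)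

ends⇒∣z-x∣+∣z-y∣≡n : ∀ {n x y} z → Ends n x y → z ≤ n → ∣ z - x ∣ + ∣ z - y ∣ ≡ n
ends⇒∣z-x∣+∣z-y∣≡n z (inj₁ (refl , refl)) z≤ = ∣z-0∣+∣z-n∣≡n z z≤
ends⇒∣z-x∣+∣z-y∣≡n z (inj₂ (refl , refl)) z≤ = trans (+-comm ∣ z - _ ∣ ∣ z - 0 ∣) (∣z-0∣+∣z-n∣≡n z z≤)

n≤∣x-y∣⇒ends : ∀ {n} x y → x ≤ n → y ≤ n → n ≤ ∣ x - y ∣ → Ends n x y
n≤∣x-y∣⇒ends zero    y       _   y≤n n≤y = inj₁ (refl , ≤-antisym y≤n n≤y)
n≤∣x-y∣⇒ends (suc x) zero    x≤n _   n≤x = inj₂ (≤-antisym x≤n n≤x , refl)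
n≤∣x-y∣⇒ends (suc x) (suc y) x≤n y≤n n≤∣x-y∣ =
  ⊥-elim (<-irrefl refl (≤-trans (s≤s (≤-trans n≤∣x-y∣ (∣m-n∣≤m⊔n x y))) (⊔-lub x≤n y≤n)))

∣x-y∣≤n : ∀ {n} x y → x ≤ n → y ≤ n → ∣ x - y ∣ ≤ n
∣x-y∣≤n x y x≤n y≤n = ≤-trans (∣m-n∣≤m⊔n x y) (⊔-lub x≤n y≤n)

∣-end∣-injective : ∀ {n e e′ x y} → Ends n e e′ → x ≤ n → y ≤ n → ∣ x - e ∣ ≡ ∣ y - e ∣ → x ≡ y
∣-end∣-injective {x = x} {y} (inj₁ (refl , refl)) _ _ eq =
  trans (sym (∣-∣-identityʳ x)) (trans eq (∣-∣-identityʳ y))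
∣-end∣-injective (inj₂ (refl , refl)) x≤n y≤n eq =
  ∸-cancelˡ-≡ x≤n y≤n (trans (sym (m≤n⇒∣m-n∣≡n∸m x≤n)) (trans eq (m≤n⇒∣m-n∣≡n∸m y≤n)))

-- As ∣ y - f ∣ + ∣ y - f′ ∣ ≡ n, the two sums determine both of their summands.
ends-distances-injective : ∀ {m n e e′ f f′ x y x′ y′} → Ends m e e′ → Ends n f f′ →
  x ≤ m → x′ ≤ m → y ≤ n → y′ ≤ n →
  ∣ x - e ∣ + ∣ y - f ∣ ≡ ∣ x′ - e ∣ + ∣ y′ - f ∣ →
  ∣ x - e ∣ + ∣ y - f′ ∣ ≡ ∣ x′ - e ∣ + ∣ y′ - f′ ∣ →
  x ≡ x′ × y ≡ y′
ends-distances-injective {y = y} {y′ = y′} E F x≤m x′≤m y≤n y′≤n e₁ e₂ =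
  let X≡X′ , Y≡Y′ = +-cancel-pairs e₁ e₂
                      (trans (ends⇒∣z-x∣+∣z-y∣≡n y F y≤n) (sym (ends⇒∣z-x∣+∣z-y∣≡n y′ F y′≤n)))
  in ∣-end∣-injective E x≤m x′≤m X≡X′ , ∣-end∣-injective F y≤n y′≤n Y≡Y′

-- Adj (Grid a b) u v is definitionally dist u v ≡ 1, since ∣ suc x - suc y ∣ reduces to ∣ x - y ∣.
dist : ∀ {a b} → Fin a × Fin b → Fin a × Fin b → ℕ
dist (i , j) (i′ , j′) = ∣ toℕ i - toℕ i′ ∣ + ∣ toℕ j - toℕ j′ ∣

dist-refl : ∀ {a b} (u : Fin a × Fin b) → dist u u ≡ 0
dist-refl (i , j) = cong₂ _+_ (∣n-n∣≡0 (toℕ i)) (∣n-n∣≡0 (toℕ j))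

dist≡0⇒≡ : ∀ {a b} (u v : Fin a × Fin b) → dist u v ≡ 0 → u ≡ v
dist≡0⇒≡ (i , j) (i′ , j′) eq =
  cong₂ _,_ (toℕ-injective (∣m-n∣≡0⇒m≡n (m+n≡0⇒m≡0 _ eq)))
            (toℕ-injective (∣m-n∣≡0⇒m≡n (m+n≡0⇒n≡0 _ eq)))

dist-triangle : ∀ {a b} (u v w : Fin a × Fin b) → dist u w ≤ dist u v + dist v w
dist-triangle (i , j) (i′ , j′) (i″ , j″) = begin
  ∣ x - x″ ∣ + ∣ y - y″ ∣
    ≤⟨ +-mono-≤ (∣-∣-triangle x x′ x″) (∣-∣-triangle y y′ y″) ⟩
  (∣ x - x′ ∣ + ∣ x′ - x″ ∣) + (∣ y - y′ ∣ + ∣ y′ - y″ ∣)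
    ≡⟨ interchange ∣ x - x′ ∣ _ _ _ ⟩
  (∣ x - x′ ∣ + ∣ y - y′ ∣) + (∣ x′ - x″ ∣ + ∣ y′ - y″ ∣) ∎
  where
  open ≤-Reasoning
  x = toℕ i ; x′ = toℕ i′ ; x″ = toℕ i″
  y = toℕ j ; y′ = toℕ j′ ; y″ = toℕ j″

fin-step : ∀ {n m} (i k : Fin n) → ∣ toℕ i - toℕ k ∣ ≡ suc m →
           Σ (Fin n) λ j → ∣ toℕ i - toℕ j ∣ ≡ 1 × ∣ toℕ j - toℕ k ∣ ≡ m
fin-step {suc (suc n)} zero (suc k) refl = suc zero , refl , refl
fin-step (suc i) zero refl =
  inject₁ i , i+1~i , trans (∣-∣-identityʳ _) (toℕ-inject₁ i)
  where
  open ≡-Reasoning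
  i+1~i : ∣ suc (toℕ i) - toℕ (inject₁ i) ∣ ≡ 1
  i+1~i = begin
    ∣ suc (toℕ i) - toℕ (inject₁ i) ∣   ≡⟨ cong (λ x → ∣ suc (toℕ i) - x ∣) (toℕ-inject₁ i) ⟩
    ∣ suc (toℕ i) - toℕ i ∣             ≡⟨ m≤n⇒∣n-m∣≡n∸m (n≤1+n (toℕ i)) ⟩
    suc (toℕ i) ∸ toℕ i                 ≡⟨ m+n∸n≡m 1 (toℕ i) ⟩
    1                                   ∎
fin-step (suc i) (suc k) eq =
  let j , i~j , j~k = fin-step i k eq in suc j , i~j , j~k

dist-step : ∀ {a b m} (u v : Fin a × Fin b) → dist u v ≡ suc m →
            ∃ λ w → Adj (Grid a b) u w × dist w v ≡ m
dist-step (i , j) (i′ , j′) eq with ∣ toℕ i - toℕ i′ ∣ in i-i′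
... | suc p = let k , i~k , k~i′ = fin-step i i′ i-i′
              in (k , j) , cong₂ _+_ i~k (∣n-n∣≡0 (toℕ j)) , trans (cong (_+ _) k~i′) (suc-injective eq)
... | zero  = let l , j~l , l~j′ = fin-step j j′ eq
              in (i , l) , cong₂ _+_ (∣n-n∣≡0 (toℕ i)) j~l , cong₂ _+_ i-i′ l~j′

endomorphism-dist-≤ : ∀ {a b} (h : Fin a × Fin b → Fin a × Fin b) → IsEndomorphism (Grid a b) h →
                      ∀ u v → dist (h u) (h v) ≤ dist u v
endomorphism-dist-≤ h endo u v = go (dist u v) u v refl
  where
  go : ∀ m u v → dist u v ≡ m → dist (h u) (h v) ≤ m
  go zero    u v d≡0 rewrite dist≡0⇒≡ u v d≡0 = ≤-reflexive (dist-refl (h v))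
  go (suc m) u v d≡m+1 =
    let w , u~w , d[w,v]≡m = dist-step u v d≡m+1
    in begin
      dist (h u) (h v)                     ≤⟨ dist-triangle (h u) (h w) (h v) ⟩
      dist (h u) (h w) + dist (h w) (h v)  ≤⟨ +-mono-≤ (≤-reflexive (endo u w u~w)) (go m w v d[w,v]≡m) ⟩
      1 + m                                ∎
    where open ≤-Reasoning

module GridCorners (m n : ℕ) where

  Point : Set
  Point = Fin (suc m) × Fin (suc n)

  G : Graph
  G = Grid (suc m) (suc n)

  ξ η : Point → ℕ
  ξ (i , _) = toℕ i
  η (_ , j) = toℕ j

  ξ≤m : ∀ p → ξ p ≤ m
  ξ≤m (i , _) = toℕ≤pred[n] i

  η≤n : ∀ p → η p ≤ n
  η≤n (_ , j) = toℕ≤pred[n] j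

  coords-injective : ∀ {p q} → ξ p ≡ ξ q → η p ≡ η q → p ≡ q
  coords-injective ξ≡ η≡ = cong₂ _,_ (toℕ-injective ξ≡) (toℕ-injective η≡)

  Opposite : Point → Point → Set
  Opposite p q = Ends m (ξ p) (ξ q) × Ends n (η p) (η q)

  opposite⇒dist-sum : ∀ {p q} → Opposite p q → ∀ w → dist w p + dist w q ≡ m + n
  opposite⇒dist-sum {p} {q} (E , F) w =
    trans (interchange ∣ ξ w - ξ p ∣ ∣ η w - η p ∣ ∣ ξ w - ξ q ∣ ∣ η w - η q ∣)
          (cong₂ _+_ (ends⇒∣z-x∣+∣z-y∣≡n (ξ w) E (ξ≤m w)) (ends⇒∣z-x∣+∣z-y∣≡n (η w) F (η≤n w)))

  opposite⇒dist≡m+n : ∀ {p q} → Opposite p q → dist p q ≡ m + n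
  opposite⇒dist≡m+n {p} {q} pq = trans (cong (_+ dist p q) (sym (dist-refl p))) (opposite⇒dist-sum pq p)

  m+n≤dist⇒opposite : ∀ p q → m + n ≤ dist p q → Opposite p q
  m+n≤dist⇒opposite p q m+n≤d =
    let Δξ≡m , Δη≡n = +-≤-squeeze (∣x-y∣≤n (ξ p) (ξ q) (ξ≤m p) (ξ≤m q))
                                  (∣x-y∣≤n (η p) (η q) (η≤n p) (η≤n q)) m+n≤d
    in n≤∣x-y∣⇒ends (ξ p) (ξ q) (ξ≤m p) (ξ≤m q) (≤-reflexive (sym Δξ≡m)) ,
       n≤∣x-y∣⇒ends (η p) (η q) (η≤n p) (η≤n q) (≤-reflexive (sym Δη≡n))

  endomorphism-opposite-preimages : ∀ h → IsEndomorphism G h → ∀ {p q} → Opposite (h p) (h q) →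
                                    Opposite p q × (∀ w → dist (h w) (h p) ≡ dist w p)
  endomorphism-opposite-preimages h endo {p} {q} hp-hq = p-q , preserves
    where
    p-q : Opposite p q
    p-q = m+n≤dist⇒opposite p q
            (subst (_≤ dist p q) (opposite⇒dist≡m+n hp-hq) (endomorphism-dist-≤ h endo p q))
    preserves : ∀ w → dist (h w) (h p) ≡ dist w p
    preserves w = proj₁ (+-≤-squeeze (endomorphism-dist-≤ h endo w p) (endomorphism-dist-≤ h endo w q)
                           (≤-reflexive (trans (opposite⇒dist-sum p-q w) (sym (opposite⇒dist-sum hp-hq (h w))))))

  Adjacent : Point → Point → Point → Set
  Adjacent p q r = (ξ r ≡ ξ p × η r ≡ η q) ⊎ (ξ r ≡ ξ q × η r ≡ η p)

  corner-adjacent : ∀ {p q r r′} → Opposite p q → Opposite r r′ → r ≢ p → r ≢ q → Adjacent p q r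
  corner-adjacent (Eₚ , Fₚ) (Eᵣ , Fᵣ) r≢p r≢q with ends-unique Eₚ Eᵣ | ends-unique Fₚ Fᵣ
  ... | inj₁ ξr≡ξp | inj₁ ηr≡ηp = ⊥-elim (r≢p (coords-injective ξr≡ξp ηr≡ηp))
  ... | inj₁ ξr≡ξp | inj₂ ηr≡ηq = inj₁ (ξr≡ξp , ηr≡ηq)
  ... | inj₂ ξr≡ξq | inj₁ ηr≡ηp = inj₂ (ξr≡ξq , ηr≡ηp)
  ... | inj₂ ξr≡ξq | inj₂ ηr≡ηq = ⊥-elim (r≢q (coords-injective ξr≡ξq ηr≡ηq))

  adjacent-corner-distances-injective : ∀ {p q r} → Opposite p q → Adjacent p q r →
    ∀ w w′ → dist w p ≡ dist w′ p → dist w r ≡ dist w′ r → w ≡ w′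
  adjacent-corner-distances-injective {p} {q} {r} (E , F) (inj₁ (ξr≡ξp , ηr≡ηq)) w w′ e₁ e₂ =
    let ξ≡ , η≡ = ends-distances-injective E F (ξ≤m w) (ξ≤m w′) (η≤n w) (η≤n w′) e₁ e₂′
    in coords-injective ξ≡ η≡
    where
    e₂′ : ∣ ξ w - ξ p ∣ + ∣ η w - η q ∣ ≡ ∣ ξ w′ - ξ p ∣ + ∣ η w′ - η q ∣
    e₂′ = subst₂ (λ a b → ∣ ξ w - a ∣ + ∣ η w - b ∣ ≡ ∣ ξ w′ - a ∣ + ∣ η w′ - b ∣) ξr≡ξp ηr≡ηq e₂
  adjacent-corner-distances-injective {p} {q} {r} (E , F) (inj₂ (ξr≡ξq , ηr≡ηp)) w w′ e₁ e₂ =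
    let η≡ , ξ≡ = ends-distances-injective F E (η≤n w) (η≤n w′) (ξ≤m w) (ξ≤m w′) e₁′ e₂′
    in coords-injective ξ≡ η≡
    where
    e₁′ : ∣ η w - η p ∣ + ∣ ξ w - ξ p ∣ ≡ ∣ η w′ - η p ∣ + ∣ ξ w′ - ξ p ∣
    e₁′ = trans (+-comm ∣ η w - η p ∣ _) (trans e₁ (+-comm ∣ ξ w′ - ξ p ∣ _))
    e₂′ : ∣ η w - η p ∣ + ∣ ξ w - ξ q ∣ ≡ ∣ η w′ - η p ∣ + ∣ ξ w′ - ξ q ∣
    e₂′ = subst₂ (λ a b → ∣ η w - b ∣ + ∣ ξ w - a ∣ ≡ ∣ η w′ - b ∣ + ∣ ξ w′ - a ∣) ξr≡ξq ηr≡ηp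
            (trans (+-comm ∣ η w - η r ∣ _) (trans e₂ (+-comm ∣ ξ w′ - ξ r ∣ _)))

  c₀₀ c₀ₙ cₘ₀ cₘₙ : Point
  c₀₀ = zero , zero
  c₀ₙ = zero , fromℕ n
  cₘ₀ = fromℕ m , zero
  cₘₙ = fromℕ m , fromℕ n

  c₀₀-cₘₙ-opposite : Opposite c₀₀ cₘₙ
  c₀₀-cₘₙ-opposite = inj₁ (refl , toℕ-fromℕ m) , inj₁ (refl , toℕ-fromℕ n)

  c₀ₙ-cₘ₀-opposite : Opposite c₀ₙ cₘ₀
  c₀ₙ-cₘ₀-opposite = inj₁ (refl , toℕ-fromℕ m) , inj₂ (toℕ-fromℕ n , refl)

  module _ .{{_ : NonZero m}} .{{_ : NonZero n}} where

    c₀ₙ≢c₀₀ : c₀ₙ ≢ c₀₀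
    c₀ₙ≢c₀₀ eq = ≢-nonZero⁻¹ n (trans (sym (toℕ-fromℕ n)) (cong η eq))

    c₀ₙ≢cₘₙ : c₀ₙ ≢ cₘₙ
    c₀ₙ≢cₘₙ eq = ≢-nonZero⁻¹ m (trans (sym (toℕ-fromℕ m)) (sym (cong ξ eq)))

    corners-covered⇒injective : ∀ h → IsEndomorphism G h → ∀ {p₀₀ p₀ₙ pₘ₀ pₘₙ} →
      h p₀₀ ≡ c₀₀ → h p₀ₙ ≡ c₀ₙ → h pₘ₀ ≡ cₘ₀ → h pₘₙ ≡ cₘₙ → Injective _≡_ _≡_ h
    corners-covered⇒injective h endo {p₀₀} {p₀ₙ} {pₘ₀} {pₘₙ} hp₀₀ hp₀ₙ hpₘ₀ hpₘₙ {w} {w′} hw≡hw′ =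
      let opp₁ , iso₁ = endomorphism-opposite-preimages h endo
                          (subst₂ Opposite (sym hp₀₀) (sym hpₘₙ) c₀₀-cₘₙ-opposite)
          opp₂ , iso₂ = endomorphism-opposite-preimages h endo
                          (subst₂ Opposite (sym hp₀ₙ) (sym hpₘ₀) c₀ₙ-cₘ₀-opposite)
      in adjacent-corner-distances-injective opp₁ (corner-adjacent opp₁ opp₂ p₀ₙ≢p₀₀ p₀ₙ≢pₘₙ) w w′
           (same-distance iso₁) (same-distance iso₂)
      where
      same-distance : ∀ {p} → (∀ u → dist (h u) (h p) ≡ dist u p) → dist w p ≡ dist w′ p
      same-distance {p} iso = trans (sym (iso w)) (trans (cong (λ x → dist x (h p)) hw≡hw′) (iso w′))
      p₀ₙ≢p₀₀ : p₀ₙ ≢ p₀₀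
      p₀ₙ≢p₀₀ eq = c₀ₙ≢c₀₀ (trans (sym hp₀ₙ) (trans (cong h eq) hp₀₀))
      p₀ₙ≢pₘₙ : p₀ₙ ≢ pₘₙ
      p₀ₙ≢pₘₙ eq = c₀ₙ≢cₘₙ (trans (sym hp₀ₙ) (trans (cong h eq) hpₘₙ))

    corners-frame : (F : VSet G) → F c₀₀ → F c₀ₙ → F cₘ₀ → F cₘₙ → IsFrame G F
    corners-frame F f₀₀ f₀ₙ fₘ₀ fₘₙ h endo covers =
      let p₀₀ , hp₀₀ = covers c₀₀ f₀₀
          p₀ₙ , hp₀ₙ = covers c₀ₙ f₀ₙ
          pₘ₀ , hpₘ₀ = covers cₘ₀ fₘ₀
          pₘₙ , hpₘₙ = covers cₘₙ fₘₙ
      in ↔-injective⇒surjective *↔× h (corners-covered⇒injective h endo hp₀₀ hp₀ₙ hpₘ₀ hpₘₙ)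

m≤n∸1⇒m<n : ∀ {m n} → 1 ≤ m → m ≤ n ∸ 1 → m < n
m≤n∸1⇒m<n {n = zero}  (s≤s _) ()
m≤n∸1⇒m<n {n = suc n} _       m≤n = s≤s m≤n

odd-bounds : ∀ {i k} → 1 ≤ i → i < k → 3 ≤ suc (2 * i) × suc (2 * i) < 2 * k
odd-bounds {i} 1≤i i<k = s≤s (*-monoʳ-≤ 2 1≤i) , ≤-trans (≤-reflexive (sym (*-suc 2 i))) (*-monoʳ-≤ 2 i<k)

∣1+2i-x∣≡1⇒x≡2i⊎x≡2[1+i] : ∀ {i x} → ∣ suc (2 * i) - x ∣ ≡ 1 → x ≡ 2 * i ⊎ x ≡ 2 * suc i
∣1+2i-x∣≡1⇒x≡2i⊎x≡2[1+i] {i} eq with ∣m-n∣≡1⇒n≡1+m⊎m≡1+n {suc (2 * i)} eq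
... | inj₁ x≡2+2i   = inj₂ (trans x≡2+2i (sym (*-suc 2 i)))
... | inj₂ 1+2i≡1+x = inj₁ (sym (suc-injective 1+2i≡1+x))

2*i+1≡1+2*i : ∀ i → 2 * i + 1 ≡ suc (2 * i)
2*i+1≡1+2*i i = +-comm (2 * i) 1

at-most-two-outside : ∀ (G : Graph) (F : VSet G) (v : V G) (label : V G → ℕ) (k : ℕ) →
  (∀ u → Adj G v u → ¬ F u → ∣ k - label u ∣ ≡ 1) →
  (∀ u w → Adj G v u → ¬ F u → Adj G v w → ¬ F w → label u ≡ label w → u ≡ w) →
  AtMostTwoNbrsOutside G F v
at-most-two-outside G F v label k unit inj (a , b , c , (va , a∉F) , (vb , b∉F) , (vc , c∉F) , a≢b , a≢c , b≢c)
  with two-of-three-equal {k} (unit a va a∉F) (unit b vb b∉F) (unit c vc c∉F)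
... | inj₁ la≡lb        = a≢b (inj a b va a∉F vb b∉F la≡lb)
... | inj₂ (inj₁ la≡lc) = a≢c (inj a c va a∉F vc c∉F la≡lc)
... | inj₂ (inj₂ lb≡lc) = b≢c (inj b c vb b∉F vc c∉F lb≡lc)

module _ {s t : ℕ} where

  private
    Vertex = Fin s × Fin t

  row-col-injective : ∀ {u v : Vertex} → row u ≡ row v → col u ≡ col v → u ≡ v
  row-col-injective r≡ c≡ = cong₂ _,_ (toℕ-injective (suc-injective r≡)) (toℕ-injective (suc-injective c≡))

  grid-adjacent : ∀ (v u : Vertex) → Adj (Grid s t) v u →
                  (row u ≡ row v × ∣ col v - col u ∣ ≡ 1) ⊎ (col u ≡ col v × ∣ row v - row u ∣ ≡ 1)
  grid-adjacent v u adj with m+n≡1⇒m≡0×n≡1⊎m≡1×n≡0 ∣ row v - row u ∣ ∣ col v - col u ∣ adj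
  ... | inj₁ (Δr≡0 , Δc≡1) = inj₁ (sym (∣m-n∣≡0⇒m≡n Δr≡0) , Δc≡1)
  ... | inj₂ (Δr≡1 , Δc≡0) = inj₂ (sym (∣m-n∣≡0⇒m≡n Δc≡0) , Δr≡1)

  lattice∈F : ∀ {u : Vertex} {i j} → 1 ≤ i → i ≤ k₁ s → 1 ≤ j → j ≤ k₂ t →
              row u ≡ 2 * i → col u ≡ 2 * j → FSet s t u
  lattice∈F 1≤i i≤k₁ 1≤j j≤k₂ r c = inj₂ (inj₂ (inj₂ (inj₂ (_ , _ , (1≤i , i≤k₁) , (1≤j , j≤k₂) , r , c))))

  F-interior⇒even : ∀ (v : Vertex) → FSet s t v → 3 ≤ row v → row v < 2 * k₁ s → 2 ≤ col v → col v ≤ 2 * k₂ t →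
                    ∃₂ λ i j → row v ≡ 2 * i × col v ≡ 2 * j
  F-interior⇒even v (inj₁ row≤2) 3≤row _ _ _ = ⊥-elim (≤⇒≯ row≤2 3≤row)
  F-interior⇒even v (inj₂ (inj₁ 2k₁≤row)) _ row<2k₁ _ _ = ⊥-elim (<⇒≱ row<2k₁ 2k₁≤row)
  F-interior⇒even v (inj₂ (inj₂ (inj₁ col≡1))) _ _ 2≤col _ = ⊥-elim (≤⇒≯ (≤-reflexive col≡1) 2≤col)
  F-interior⇒even v (inj₂ (inj₂ (inj₂ (inj₁ 2k₂<col)))) _ _ _ col≤2k₂ = ⊥-elim (<⇒≱ 2k₂<col col≤2k₂)
  F-interior⇒even v (inj₂ (inj₂ (inj₂ (inj₂ (i , j , _ , _ , r , c))))) _ _ _ _ = i , j , r , c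

  F∩D≡∅ : ∀ v → ¬ (FSet s t v × DSet s t v)
  F∩D≡∅ v (v∈F , inj₁ (i , j , (1≤i , i≤) , (1≤j , j≤k₂) , r , c)) =
    let r′ = trans r (2*i+1≡1+2*i i)
        3≤row , row<2k₁ = odd-bounds 1≤i (m≤n∸1⇒m<n {n = k₁ s} 1≤i i≤)
        i′ , _ , row≡2i′ , _ = F-interior⇒even v v∈F
                                 (subst (3 ≤_) (sym r′) 3≤row) (subst (_< 2 * k₁ s) (sym r′) row<2k₁)
                                 (subst (2 ≤_) (sym c) (*-monoʳ-≤ 2 1≤j))
                                 (subst (_≤ 2 * k₂ t) (sym c) (*-monoʳ-≤ 2 j≤k₂))
    in even≢odd i′ i (trans (sym row≡2i′) r′)
  F∩D≡∅ v (v∈F , inj₂ (i , j , (1<i , i<k₁) , (1≤j , j≤) , r , c)) =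
    let c′ = trans c (2*i+1≡1+2*i j)
        3≤col , col<2k₂ = odd-bounds 1≤j (m≤n∸1⇒m<n {n = k₂ t} 1≤j j≤)
        _ , j′ , _ , col≡2j′ = F-interior⇒even v v∈F
                                 (subst (3 ≤_) (sym r) (≤-trans (n≤1+n 3) (*-monoʳ-≤ 2 1<i)))
                                 (subst (_< 2 * k₁ s) (sym r) (*-monoʳ-< 2 i<k₁))
                                 (subst (2 ≤_) (sym c′) (≤-trans (n≤1+n 2) 3≤col))
                                 (subst (_≤ 2 * k₂ t) (sym c′) (<⇒≤ col<2k₂))
    in even≢odd j′ j (trans (sym col≡2j′) c′)

  row-aligned⇒at-most-two-outside : ∀ (F : VSet (Grid s t)) v →
    (∀ u → Adj (Grid s t) v u → ¬ F u → row u ≡ row v) → AtMostTwoNbrsOutside (Grid s t) F v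
  row-aligned⇒at-most-two-outside F v aligned = at-most-two-outside (Grid s t) F v col (col v) unit inj
    where
    unit : ∀ u → Adj (Grid s t) v u → ¬ F u → ∣ col v - col u ∣ ≡ 1
    unit u adj u∉F with grid-adjacent v u adj
    ... | inj₁ (_ , Δc≡1) = Δc≡1
    ... | inj₂ (_ , Δr≡1) = ⊥-elim (0≢1+n (trans (sym (m≡n⇒∣m-n∣≡0 (sym (aligned u adj u∉F)))) Δr≡1))
    inj : ∀ u w → Adj (Grid s t) v u → ¬ F u → Adj (Grid s t) v w → ¬ F w → col u ≡ col w → u ≡ w
    inj u w vu u∉F vw w∉F = row-col-injective (trans (aligned u vu u∉F) (sym (aligned w vw w∉F)))

  col-aligned⇒at-most-two-outside : ∀ (F : VSet (Grid s t)) v →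
    (∀ u → Adj (Grid s t) v u → ¬ F u → col u ≡ col v) → AtMostTwoNbrsOutside (Grid s t) F v
  col-aligned⇒at-most-two-outside F v aligned = at-most-two-outside (Grid s t) F v row (row v) unit inj
    where
    unit : ∀ u → Adj (Grid s t) v u → ¬ F u → ∣ row v - row u ∣ ≡ 1
    unit u adj u∉F with grid-adjacent v u adj
    ... | inj₂ (_ , Δr≡1) = Δr≡1
    ... | inj₁ (_ , Δc≡1) = ⊥-elim (0≢1+n (trans (sym (m≡n⇒∣m-n∣≡0 (sym (aligned u adj u∉F)))) Δc≡1))
    inj : ∀ u w → Adj (Grid s t) v u → ¬ F u → Adj (Grid s t) v w → ¬ F w → row u ≡ row w → u ≡ w
    inj u w vu u∉F vw w∉F r≡ = row-col-injective r≡ (trans (aligned u vu u∉F) (sym (aligned w vw w∉F)))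

  D⇒at-most-two-outside : ∀ v → DSet s t v → AtMostTwoNbrsOutside (Grid s t) (FSet s t) v
  D⇒at-most-two-outside v (inj₁ (i , j , (1≤i , i≤) , (1≤j , j≤k₂) , r , c)) =
    row-aligned⇒at-most-two-outside (FSet s t) v aligned
    where
    i<k₁ : i < k₁ s
    i<k₁ = m≤n∸1⇒m<n {n = k₁ s} 1≤i i≤
    aligned : ∀ u → Adj (Grid s t) v u → ¬ FSet s t u → row u ≡ row v
    aligned u adj u∉F with grid-adjacent v u adj
    ... | inj₁ (r≡ , _)    = r≡
    ... | inj₂ (c≡ , Δr≡1)
      with ∣1+2i-x∣≡1⇒x≡2i⊎x≡2[1+i] (subst (λ x → ∣ x - row u ∣ ≡ 1) (trans r (2*i+1≡1+2*i i)) Δr≡1)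
    ...   | inj₁ row≡2i     = ⊥-elim (u∉F (lattice∈F 1≤i (<⇒≤ i<k₁) 1≤j j≤k₂ row≡2i (trans c≡ c)))
    ...   | inj₂ row≡2[1+i] = ⊥-elim (u∉F (lattice∈F (s≤s z≤n) i<k₁ 1≤j j≤k₂ row≡2[1+i] (trans c≡ c)))
  D⇒at-most-two-outside v (inj₂ (i , j , (1<i , i<k₁) , (1≤j , j≤) , r , c)) =
    col-aligned⇒at-most-two-outside (FSet s t) v aligned
    where
    j<k₂ : j < k₂ t
    j<k₂ = m≤n∸1⇒m<n {n = k₂ t} 1≤j j≤
    1≤i : 1 ≤ i
    1≤i = <⇒≤ 1<i
    aligned : ∀ u → Adj (Grid s t) v u → ¬ FSet s t u → col u ≡ col v
    aligned u adj u∉F with grid-adjacent v u adj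
    ... | inj₂ (c≡ , _)    = c≡
    ... | inj₁ (r≡ , Δc≡1)
      with ∣1+2i-x∣≡1⇒x≡2i⊎x≡2[1+i] (subst (λ x → ∣ x - col u ∣ ≡ 1) (trans c (2*i+1≡1+2*i j)) Δc≡1)
    ...   | inj₁ col≡2j     = ⊥-elim (u∉F (lattice∈F 1≤i (<⇒≤ i<k₁) 1≤j (<⇒≤ j<k₂) (trans r≡ r) col≡2j))
    ...   | inj₂ col≡2[1+j] = ⊥-elim (u∉F (lattice∈F 1≤i (<⇒≤ i<k₁) (s≤s z≤n) j<k₂ (trans r≡ r) col≡2[1+j]))

2*⌊n/2⌋≤n : ∀ n → 2 * ⌊ n /2⌋ ≤ n
2*⌊n/2⌋≤n zero          = z≤n
2*⌊n/2⌋≤n (suc zero)    = z≤n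
2*⌊n/2⌋≤n (suc (suc n)) = ≤-trans (≤-reflexive (*-suc 2 ⌊ n /2⌋)) (s≤s (s≤s (2*⌊n/2⌋≤n n)))

lemma5p5 : (s t : ℕ) → 5 ≤ s → 6 ≤ t → IsSkeleton (Grid s t) (FSet s t) (DSet s t)
lemma5p5 (suc m) (suc n) (s≤s (s≤s _)) (s≤s (s≤s _)) =
  corners-frame (FSet (suc m) (suc n)) (inj₁ (s≤s z≤n)) (inj₁ (s≤s z≤n)) (inj₂ (inj₂ (inj₁ refl))) cₘₙ∈F ,
  F∩D≡∅ , D⇒at-most-two-outside
  where
  open GridCorners m n
  cₘₙ∈F : FSet (suc m) (suc n) cₘₙ
  cₘₙ∈F = inj₂ (inj₁ (begin
    2 * ⌊ m /2⌋    ≤⟨ 2*⌊n/2⌋≤n m ⟩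
    m              ≤⟨ n≤1+n m ⟩
    suc m          ≡⟨ cong suc (toℕ-fromℕ m) ⟨
    row cₘₙ        ∎))
    where open ≤-Reasoning
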